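{- Let $p=3$, $k=1$, $e\ge1$, and $n=3^{l_1}+3^{l_2}+3^{l_3}+3^{l_4}$ where $l_1,l_2,l_3,l_4$ are non-negative integers. Assume that exactly two of $l_1,l_2,l_3,l_4$ are zero and the two non-zero ones are either both odd or of different parity. Then $D_{n,1}(1,x)$ is not a permutation polynomial of $\mathbb{F}_{3^e}$.
   Context: For an odd prime $p$ and $0\le k\le p-1$: for $n\ge 1$, $D_{n,k}(1,x)=\sum_{i=0}^{\lfloor n/2\rfloor}\frac{n-ki}{n-i}\binom{n-i}{i}(-x)^i$, where the coefficient is the integer $\binom{n-i}{i}-(k-1)\binom{n-i-1}{i-1}$ (with $\binom{m}{ -1}=0$) viewed in $\mathbb{F}_p$; $D_{0,k}(1,x)=2-k$. Equivalently $D_{1,k}=1$ and $D_{n,k}=D_{n-1,k}-xD_{n-2,k}$ for $n\ge2$. A polynomial over $\mathbb{F}_q$ is a permutation polynomial of $\mathbb{F}_q$ if it induces a bijection of $\mathbb{F}_q$. -}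

module Defs where

open import Level using (0ℓ)
open import Data.Nat using (ℕ; zero; suc; _∸_; _^_; _%_; _/_; _≟_)
import Data.Nat as ℕ
open import Data.Nat.Combinatorics using (_C_)
open import Data.Fin using (Fin)
open import Data.List using (List; []; _∷_; filter; length)
open import Data.Product using (Σ; ∃; _×_; _,_)
open import Data.Sum using (_⊎_)
open import Relation.Nullary using (¬_)
open import Relation.Unary using (∁)
open import Relation.Binary.PropositionalEquality using (_≡_)
open import Algebra.Core using (Op₁; Op₂)
import Algebra.Structures as AS
open import Function.Bundles using (_⤖_)
open import Function.Definitions using (Bijective)

-- A finite field with exactly q elements (equality is propositional equality).
-- The field F_{3^e} is any such field with q = 3^e (unique up to isomorphism).
record FiniteField (q : ℕ) : Set₁ where
  infixl 7 _*_
  infixl 6 _+_ _-_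
  field
    Carrier : Set
    _+_ _*_ : Op₂ Carrier
    -_      : Op₁ Carrier
    0# 1#   : Carrier
    isCommutativeRing : AS.IsCommutativeRing (_≡_ {A = Carrier}) _+_ _*_ -_ 0# 1#
    0≢1     : ¬ (0# ≡ 1#)
    inverse : ∀ x → ¬ (x ≡ 0#) → ∃ λ y → x * y ≡ 1#
    card    : Fin q ⤖ Carrier

  _-_ : Op₂ Carrier
  x - y = x + (- y)

  fromℕ : ℕ → Carrier
  fromℕ zero    = 0#
  fromℕ (suc n) = 1# + fromℕ n

  _^^_ : Carrier → ℕ → Carrier
  x ^^ zero  = 1#
  x ^^ suc n = x * (x ^^ n)

-- binomial coefficient C(m, i-1) with the convention C(m,-1) = 0,
-- written as a function of i (so i = 0 gives 0).
binomPred : ℕ → ℕ → ℕ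
binomPred m zero    = 0
binomPred m (suc j) = m C j

module Dickson {q : ℕ} (F : FiniteField q) where
  open FiniteField F

  -- coefficient of (-x)^i in D_{n,k}(1,x):
  --   C(n-i, i) - (k-1) C(n-i-1, i-1), viewed in the field
  coeff : ℕ → ℕ → ℕ → Carrier
  coeff k n i = fromℕ ((n ∸ i) C i) - ((fromℕ k - 1#) * fromℕ (binomPred (n ∸ i ∸ 1) i))

  partialSum : ℕ → ℕ → Carrier → ℕ → Carrier
  partialSum k n x zero    = coeff k n 0 * ((- x) ^^ 0)
  partialSum k n x (suc m) = partialSum k n x m + coeff k n (suc m) * ((- x) ^^ suc m)

  D : ℕ → ℕ → Carrier → Carrier
  D zero    k x = fromℕ 2 - fromℕ k
  D (suc m) k x = partialSum k (suc m) x (suc m / 2)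

  IsPermutation : (Carrier → Carrier) → Set
  IsPermutation f = Bijective _≡_ _≡_ f

Even : ℕ → Set
Even n = n % 2 ≡ 0

Odd : ℕ → Set
Odd n = n % 2 ≡ 1

Hypothesis : ℕ → ℕ → ℕ → ℕ → Set
Hypothesis l₁ l₂ l₃ l₄ =
  length (filter (λ n → n ≟ 0) ls) ≡ 2 ×
  (∀ a b → filter (λ n → ¬? (n ≟ 0)) ls ≡ a ∷ b ∷ [] →
     (Odd a × Odd b) ⊎ (Even a × Odd b) ⊎ (Odd a × Even b))
  where
    ls = l₁ ∷ l₂ ∷ l₃ ∷ l₄ ∷ []
    open import Relation.Nullary.Decidable using (¬?)

module Submission where

-- D_{n,1}(1, x) is not a permutation polynomial of F_{3^e} because it takes the
-- same value at the two distinct points x = 0 and x = -1.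
--
-- For k = 1 the coefficients of D_{n,1}(1, x) are the binomials C(n-i, i), so
--   * D_{n,1}(1, 0) = C(n, 0) = 1, and
--   * D_{n,1}(1, -1) = Σ_i C(n-i, i), the sum along a shallow diagonal of Pascal's
--     triangle, which is the Fibonacci number F_{n+1}.
-- Fibonacci numbers are periodic mod 3 with period 8, and 3^a ≡ 3^(a mod 2) (mod 8).
-- Under the hypothesis n = 2 + 3^A + 3^B with A, B not both even, so n + 1 ≡ 1 or 7
-- (mod 8) and F_{n+1} ≡ F_9 or F_7 ≡ 1 (mod 3).  Finally a field of order 3^e has
-- characteristic 3 (the order kills 1, and there are no zero divisors), so
-- D_{n,1}(1, -1) = 1 = D_{n,1}(1, 0).

open import Defs
open import Data.Nat using (ℕ)

module Arithmetic where

  open import Data.Nat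
  open import Data.Nat.Properties
  open import Data.Nat.DivMod using (_/_; _%_; m≡m%n+[m/n]*n; m/n≤m; m%n<n; [m+kn]%n≡m%n)
  open import Data.Nat.Combinatorics using (_C_; nCk+nC[k+1]≡[n+1]C[k+1]; k>n⇒nCk≡0)
  open import Data.Nat.Tactic.RingSolver using (solve)
  open import Algebra.Properties.CommutativeSemigroup +-commutativeSemigroup using (interchange)
  open import Data.List using (_∷_; [])
  open import Data.Product using (∃; ∃₂; _×_; _,_)
  open import Data.Sum using (_⊎_; inj₁; inj₂)
  open import Relation.Binary.PropositionalEquality
  open import Relation.Nullary using (yes; no)

  diagonalTerm : ℕ → ℕ → ℕ
  diagonalTerm n i = (n ∸ i) C i

  -- Σ_{i ≤ m} C(n - i, i), summed in the same order as Dickson.partialSum.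
  diagonalSum : ℕ → ℕ → ℕ
  diagonalSum n zero    = diagonalTerm n 0
  diagonalSum n (suc m) = diagonalSum n m + diagonalTerm n (suc m)

  diagonalTerm-pascal : ∀ n j →
    diagonalTerm (2 + n) (1 + j) ≡ diagonalTerm (1 + n) (1 + j) + diagonalTerm n j
  diagonalTerm-pascal n j with j ≤? n
  ... | yes j≤n = begin
    (suc n ∸ j) C suc j            ≡⟨ cong (_C suc j) (+-∸-assoc 1 j≤n) ⟩
    suc (n ∸ j) C suc j            ≡⟨ nCk+nC[k+1]≡[n+1]C[k+1] (n ∸ j) j ⟨
    (n ∸ j) C j + (n ∸ j) C suc j  ≡⟨ +-comm ((n ∸ j) C j) _ ⟩
    (n ∸ j) C suc j + (n ∸ j) C j  ∎
    where open ≡-Reasoning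
  ... | no j≰n
    rewrite m≤n⇒m∸n≡0 (≰⇒> j≰n) | m≤n⇒m∸n≡0 (<⇒≤ (≰⇒> j≰n))
    = sym (k>n⇒nCk≡0 (≤-trans (s≤s z≤n) (≰⇒> j≰n)))

  diagonalSum-pascal : ∀ n m →
    diagonalSum (2 + n) (1 + m) ≡ diagonalSum (1 + n) (1 + m) + diagonalSum n m
  diagonalSum-pascal n zero = cong (1 +_) (diagonalTerm-pascal n 0)
  diagonalSum-pascal n (suc m) = begin
    diagonalSum (2 + n) (1 + m) + diagonalTerm (2 + n) (2 + m)
      ≡⟨ cong₂ _+_ (diagonalSum-pascal n m) (diagonalTerm-pascal n (suc m)) ⟩
    (a + b) + (c + d)
      ≡⟨ interchange a b c d ⟩
    (a + c) + (b + d) ∎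
    where
      open ≡-Reasoning
      a = diagonalSum (1 + n) (1 + m)
      b = diagonalSum n m
      c = diagonalTerm (1 + n) (2 + m)
      d = diagonalTerm n (1 + m)

  diagonalSum-stable : ∀ n m → (∀ i → m < i → diagonalTerm n i ≡ 0) →
    ∀ j → diagonalSum n (m + j) ≡ diagonalSum n m
  diagonalSum-stable n m vanish zero = cong (diagonalSum n) (+-identityʳ m)
  diagonalSum-stable n m vanish (suc j) = begin
    diagonalSum n (m + suc j)                                ≡⟨ cong (diagonalSum n) (+-suc m j) ⟩
    diagonalSum n (m + j) + diagonalTerm n (suc (m + j))     ≡⟨ cong₂ _+_ (diagonalSum-stable n m vanish j)
                                                                 (vanish (suc (m + j)) (s≤s (m≤m+n m j))) ⟩
    diagonalSum n m + 0                                      ≡⟨ +-identityʳ _ ⟩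
    diagonalSum n m                                          ∎
    where open ≡-Reasoning

  -- C(n - i, i) = 0 as soon as i > n / 2, because then n - i < i.
  diagonalTerm-beyond-half : ∀ n i → n / 2 < i → diagonalTerm n i ≡ 0
  diagonalTerm-beyond-half n i half<i = k>n⇒nCk≡0 (m<n+o⇒m∸n<o n i {{>-nonZero (≤-trans z<s half<i)}} n<i+i)
    where
      double : ∀ k → 2 + k * 2 ≡ suc k + suc k
      double k = solve (k ∷ [])

      open ≤-Reasoning
      n<i+i : n < i + i
      n<i+i = begin-strict
        n                                 ≡⟨ m≡m%n+[m/n]*n n 2 ⟩
        n % 2 + n / 2 * 2                 <⟨ +-monoˡ-< (n / 2 * 2) (m%n<n n 2) ⟩
        2 + n / 2 * 2                     ≡⟨ double (n / 2) ⟩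
        suc (n / 2) + suc (n / 2)         ≤⟨ +-mono-≤ half<i half<i ⟩
        i + i                             ∎

  diagonalSum-half : ∀ n → diagonalSum n (n / 2) ≡ diagonalSum n n
  diagonalSum-half n = begin
    diagonalSum n (n / 2)                    ≡⟨ diagonalSum-stable n (n / 2) (diagonalTerm-beyond-half n) (n ∸ n / 2) ⟨
    diagonalSum n (n / 2 + (n ∸ n / 2))      ≡⟨ cong (diagonalSum n) (m+[n∸m]≡n (m/n≤m n 2)) ⟩
    diagonalSum n n                          ∎
    where open ≡-Reasoning

  fib : ℕ → ℕ
  fib 0 = 0
  fib 1 = 1
  fib (suc (suc n)) = fib (suc n) + fib n

  diagonalSum≡fib : ∀ n → diagonalSum n n ≡ fib (suc n)
  diagonalSum≡fib 0 = refl
  diagonalSum≡fib 1 = refl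
  diagonalSum≡fib (suc (suc n)) = begin
    diagonalSum (2 + n) (1 + n) + diagonalTerm (2 + n) (2 + n)  ≡⟨ cong (λ t → diagonalSum (2 + n) (1 + n) + t C (2 + n)) (n∸n≡0 n) ⟩
    diagonalSum (2 + n) (1 + n) + 0                             ≡⟨ +-identityʳ _ ⟩
    diagonalSum (2 + n) (1 + n)                                 ≡⟨ diagonalSum-pascal n n ⟩
    diagonalSum (1 + n) (1 + n) + diagonalSum n n               ≡⟨ cong₂ _+_ (diagonalSum≡fib (suc n)) (diagonalSum≡fib n) ⟩
    fib (2 + n) + fib (1 + n)                                   ∎
    where open ≡-Reasoning

  fib-+ : ∀ m n → fib (suc m + n) ≡ fib (suc m) * fib (suc n) + fib m * fib n
  fib-+ zero n = sym (trans (+-identityʳ _) (+-identityʳ _))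
  fib-+ (suc zero) n = sym (cong₂ _+_ (+-identityʳ (fib (suc n))) (+-identityʳ (fib n)))
  fib-+ (suc (suc m)) n = begin
    fib (suc (suc m) + n) + fib (suc m + n)
      ≡⟨ cong₂ _+_ (fib-+ (suc m) n) (fib-+ m n) ⟩
    (fib (2 + m) * fib (suc n) + fib (1 + m) * fib n) + (fib (1 + m) * fib (suc n) + fib m * fib n)
      ≡⟨ regroup (fib (2 + m)) (fib (1 + m)) (fib m) (fib (suc n)) (fib n) ⟩
    (fib (2 + m) + fib (1 + m)) * fib (suc n) + (fib (1 + m) + fib m) * fib n ∎
    where
      open ≡-Reasoning
      regroup : ∀ a b c x y → (a * x + b * y) + (b * x + c * y) ≡ (a + b) * x + (b + c) * y
      regroup a b c x y = solve (a ∷ b ∷ c ∷ x ∷ y ∷ [])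

  CongruentMod8 : ℕ → ℕ → Set
  CongruentMod8 n r = ∃ λ Q → n ≡ Q * 8 + r

  mod8-+ : ∀ {m n r s} → CongruentMod8 m r → CongruentMod8 n s → CongruentMod8 (m + n) (r + s)
  mod8-+ {r = r} {s} (P , refl) (Q , refl) = P + Q , regroup P Q r s
    where
      regroup : ∀ P Q r s → (P * 8 + r) + (Q * 8 + s) ≡ (P + Q) * 8 + (r + s)
      regroup P Q r s = solve (P ∷ Q ∷ r ∷ s ∷ [])

  -- 9 ≡ 1 (mod 8), hence every even power of 3 is 1 modulo 8 ...
  pow3-even-mod8 : ∀ k → CongruentMod8 (3 ^ (k * 2)) 1
  pow3-even-mod8 zero = 0 , refl
  pow3-even-mod8 (suc k) with pow3-even-mod8 k
  ... | Q , eq = 1 + 9 * Q , trans (cong (λ t → 3 * (3 * t)) eq) (nine-times Q)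
    where
      nine-times : ∀ Q → 3 * (3 * (Q * 8 + 1)) ≡ (1 + 9 * Q) * 8 + 1
      nine-times Q = solve (Q ∷ [])

  pow3-mod8 : ∀ a → CongruentMod8 (3 ^ a) (3 ^ (a % 2))
  pow3-mod8 a with pow3-even-mod8 (a / 2)
  ... | Q , eq = 3 ^ (a % 2) * Q , (begin
    3 ^ a                             ≡⟨ cong (3 ^_) (m≡m%n+[m/n]*n a 2) ⟩
    3 ^ (a % 2 + a / 2 * 2)           ≡⟨ ^-distribˡ-+-* 3 (a % 2) (a / 2 * 2) ⟩
    3 ^ (a % 2) * 3 ^ (a / 2 * 2)     ≡⟨ cong (3 ^ (a % 2) *_) eq ⟩
    3 ^ (a % 2) * (Q * 8 + 1)         ≡⟨ distribute (3 ^ (a % 2)) Q ⟩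
    3 ^ (a % 2) * Q * 8 + 3 ^ (a % 2) ∎)
    where
      open ≡-Reasoning
      distribute : ∀ c Q → c * (Q * 8 + 1) ≡ c * Q * 8 + c
      distribute c Q = solve (c ∷ Q ∷ [])

  -- Pisano period: F_{n+8} = F_n + 3 (7 F_{n+1} + 4 F_n), so F mod 3 has period 8.
  fib-mod3-period : ∀ {n r} → CongruentMod8 n r → fib n % 3 ≡ fib r % 3
  fib-mod3-period (zero , refl) = refl
  fib-mod3-period {r = r} (suc Q , refl) = begin
    fib (8 + Q * 8 + r) % 3                         ≡⟨ cong (λ k → fib k % 3) (+-assoc 8 (Q * 8) r) ⟩
    fib (8 + n) % 3                                 ≡⟨ cong (_% 3) (fib-+ 7 n) ⟩
    (21 * fib (suc n) + 13 * fib n) % 3             ≡⟨ cong (_% 3) (split (fib (suc n)) (fib n)) ⟩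
    (fib n + (7 * fib (suc n) + 4 * fib n) * 3) % 3 ≡⟨ [m+kn]%n≡m%n (fib n) (7 * fib (suc n) + 4 * fib n) 3 ⟩
    fib n % 3                                       ≡⟨ fib-mod3-period (Q , refl) ⟩
    fib r % 3                                       ∎
    where
      open ≡-Reasoning
      n = Q * 8 + r
      split : ∀ a b → 21 * a + 13 * b ≡ b + (7 * a + 4 * b) * 3
      split a b = solve (a ∷ b ∷ [])

  ParityCondition : ℕ → ℕ → Set
  ParityCondition A B = (Odd A × Odd B) ⊎ (Even A × Odd B) ⊎ (Odd A × Even B)

  -- Under the parity condition 3 + 3^A + 3^B ≡ 9 or 7 (mod 8), and F_9 = 34, F_7 = 13 are ≡ 1 (mod 3).
  -- (Both exponents even would give 5, and F_5 = 5 ≢ 1.)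
  fib-two-powers : ∀ A B → ParityCondition A B → fib (3 + 3 ^ A + 3 ^ B) % 3 ≡ 1
  fib-two-powers A B parity = trans (fib-mod3-period congruence) (residue parity)
    where
      congruence : CongruentMod8 (3 + 3 ^ A + 3 ^ B) (3 + 3 ^ (A % 2) + 3 ^ (B % 2))
      congruence = mod8-+ (mod8-+ (0 , refl) (pow3-mod8 A)) (pow3-mod8 B)

      residue : ParityCondition A B → fib (3 + 3 ^ (A % 2) + 3 ^ (B % 2)) % 3 ≡ 1
      residue (inj₁ (oddA , oddB))         rewrite oddA | oddB = refl
      residue (inj₂ (inj₁ (evenA , oddB))) rewrite evenA | oddB = refl
      residue (inj₂ (inj₂ (oddA , evenB))) rewrite oddA | evenB = refl

  hypothesis-normalForm : ∀ l₁ l₂ l₃ l₄ → Hypothesis l₁ l₂ l₃ l₄ →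
    ∃₂ λ A B → ParityCondition A B × 3 ^ l₁ + 3 ^ l₂ + 3 ^ l₃ + 3 ^ l₄ ≡ 2 + 3 ^ A + 3 ^ B
  hypothesis-normalForm zero    zero    zero    zero    (() , _)
  hypothesis-normalForm zero    zero    zero    (suc d) (() , _)
  hypothesis-normalForm zero    zero    (suc c) zero    (() , _)
  hypothesis-normalForm zero    zero    (suc c) (suc d) (_ , H) = suc c , suc d , H _ _ refl , refl
  hypothesis-normalForm zero    (suc b) zero    zero    (() , _)
  hypothesis-normalForm zero    (suc b) zero    (suc d) (_ , H) = suc b , suc d , H _ _ refl , reorder (3 ^ suc b) (3 ^ suc d)
    where reorder : ∀ x y → 1 + x + 1 + y ≡ 2 + x + y
          reorder x y = solve (x ∷ y ∷ [])
  hypothesis-normalForm zero    (suc b) (suc c) zero    (_ , H) = suc b , suc c , H _ _ refl , reorder (3 ^ suc b) (3 ^ suc c)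
    where reorder : ∀ x y → 1 + x + y + 1 ≡ 2 + x + y
          reorder x y = solve (x ∷ y ∷ [])
  hypothesis-normalForm zero    (suc b) (suc c) (suc d) (() , _)
  hypothesis-normalForm (suc a) zero    zero    zero    (() , _)
  hypothesis-normalForm (suc a) zero    zero    (suc d) (_ , H) = suc a , suc d , H _ _ refl , reorder (3 ^ suc a) (3 ^ suc d)
    where reorder : ∀ x y → x + 1 + 1 + y ≡ 2 + x + y
          reorder x y = solve (x ∷ y ∷ [])
  hypothesis-normalForm (suc a) zero    (suc c) zero    (_ , H) = suc a , suc c , H _ _ refl , reorder (3 ^ suc a) (3 ^ suc c)
    where reorder : ∀ x y → x + 1 + y + 1 ≡ 2 + x + y
          reorder x y = solve (x ∷ y ∷ [])
  hypothesis-normalForm (suc a) zero    (suc c) (suc d) (() , _)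
  hypothesis-normalForm (suc a) (suc b) zero    zero    (_ , H) = suc a , suc b , H _ _ refl , reorder (3 ^ suc a) (3 ^ suc b)
    where reorder : ∀ x y → x + y + 1 + 1 ≡ 2 + x + y
          reorder x y = solve (x ∷ y ∷ [])
  hypothesis-normalForm (suc a) (suc b) zero    (suc d) (() , _)
  hypothesis-normalForm (suc a) (suc b) (suc c) zero    (() , _)
  hypothesis-normalForm (suc a) (suc b) (suc c) (suc d) (() , _)

  fib-index : ∀ l₁ l₂ l₃ l₄ → Hypothesis l₁ l₂ l₃ l₄ →
    fib (suc (3 ^ l₁ + 3 ^ l₂ + 3 ^ l₃ + 3 ^ l₄)) % 3 ≡ 1
  fib-index l₁ l₂ l₃ l₄ hyp with hypothesis-normalForm l₁ l₂ l₃ l₄ hyp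
  ... | A , B , parity , sum≡ rewrite sum≡ = fib-two-powers A B parity


module FieldFacts {q : ℕ} (F : FiniteField q) where
  import Data.Nat as ℕ
  open import Data.Nat using (zero; suc; NonZero)
  open import Data.Nat.DivMod using (_%_; _/_; m≡m%n+[m/n]*n)
  open import Data.Fin using (Fin)
  open import Data.Product using (_,_)
  open import Relation.Nullary using (¬_)
  open import Relation.Binary.PropositionalEquality
  open import Function.Bundles using (_↔_; Inverse; mk↔ₛ′)
  open import Function.Properties.Bijection using (⤖⇒↔)
  open import Function.Properties.Inverse using (↔-trans; ↔-sym)
  open import Data.Fin.Permutation using (Permutation)
  open import Algebra.Bundles using (CommutativeRing)
  open import Algebra.Structures using (IsCommutativeRing)
  open import Level using (0ℓ)
  open Arithmetic using (diagonalTerm; diagonalSum; diagonalSum-half; diagonalSum≡fib; fib)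

  open FiniteField F
  open Dickson F
  open IsCommutativeRing isCommutativeRing
    using (+-identityʳ; +-assoc; -‿inverseˡ; -‿inverseʳ;
           *-identityˡ; *-identityʳ; *-comm; *-assoc; zeroˡ; zeroʳ)
  open ≡-Reasoning

  ring : CommutativeRing 0ℓ 0ℓ
  ring = record { isCommutativeRing = isCommutativeRing }

  open import Algebra.Properties.Ring (CommutativeRing.ring ring)
    using (-0#≈0#; -‿involutive; +-identityʳ-unique)
  open import Algebra.Properties.Semiring.Mult (CommutativeRing.semiring ring)
    using (_×_; ×-homo-+; ×1-homo-*)
  open import Algebra.Properties.CommutativeMonoid.Sum (CommutativeRing.+-commutativeMonoid ring)
    using (sum; sum-permute; sum-cong-≗; ∑-distrib-+; sum-replicate)

  fromℕ≡×1 : ∀ n → fromℕ n ≡ n × 1#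
  fromℕ≡×1 zero    = refl
  fromℕ≡×1 (suc n) = cong (1# +_) (fromℕ≡×1 n)

  fromℕ-+ : ∀ m n → fromℕ (m ℕ.+ n) ≡ fromℕ m + fromℕ n
  fromℕ-+ m n = begin
    fromℕ (m ℕ.+ n)      ≡⟨ fromℕ≡×1 (m ℕ.+ n) ⟩
    (m ℕ.+ n) × 1#       ≡⟨ ×-homo-+ 1# m n ⟩
    m × 1# + n × 1#      ≡⟨ cong₂ _+_ (fromℕ≡×1 m) (fromℕ≡×1 n) ⟨
    fromℕ m + fromℕ n    ∎

  fromℕ-* : ∀ m n → fromℕ (m ℕ.* n) ≡ fromℕ m * fromℕ n
  fromℕ-* m n = begin
    fromℕ (m ℕ.* n)      ≡⟨ fromℕ≡×1 (m ℕ.* n) ⟩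
    (m ℕ.* n) × 1#       ≡⟨ ×1-homo-* m n ⟩
    (m × 1#) * (n × 1#)  ≡⟨ cong₂ _*_ (fromℕ≡×1 m) (fromℕ≡×1 n) ⟨
    fromℕ m * fromℕ n    ∎

  fromℕ-^ : ∀ m e → fromℕ (m ℕ.^ e) ≡ fromℕ m ^^ e
  fromℕ-^ m zero    = +-identityʳ 1#
  fromℕ-^ m (suc e) = trans (fromℕ-* m (m ℕ.^ e)) (cong (fromℕ m *_) (fromℕ-^ m e))

  translation : Carrier ↔ Carrier
  translation = mk↔ₛ′ (_+ 1#) (_- 1#) cancel-1 cancel+1
    where
      cancel-1 : ∀ x → (x - 1#) + 1# ≡ x
      cancel-1 x = trans (+-assoc x (- 1#) 1#) (trans (cong (x +_) (-‿inverseˡ 1#)) (+-identityʳ x))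
      cancel+1 : ∀ x → (x + 1#) - 1# ≡ x
      cancel+1 x = trans (+-assoc x 1# (- 1#)) (trans (cong (x +_) (-‿inverseʳ 1#)) (+-identityʳ x))

  -- The order of the field annihilates 1: q · 1 = 0.  Summing all elements,
  -- Σ x = Σ (x + 1) = Σ x + q · 1, since translation permutes the field.
  fromℕ-card : fromℕ q ≡ 0#
  fromℕ-card = begin
    fromℕ q    ≡⟨ fromℕ≡×1 q ⟩
    q × 1#     ≡⟨ +-identityʳ-unique (sum element) (q × 1#) shifted ⟩
    0#         ∎
    where
      enumeration : Fin q ↔ Carrier
      enumeration = ⤖⇒↔ card
      element : Fin q → Carrier
      element = Inverse.to enumeration
      shift : Permutation q q
      shift = ↔-trans enumeration (↔-trans translation (↔-sym enumeration))
      shifted : sum element + q × 1# ≡ sum element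
      shifted = begin
        sum element + q × 1#                 ≡⟨ cong (sum element +_) (sum-replicate q) ⟨
        sum element + sum {q} (λ _ → 1#)     ≡⟨ ∑-distrib-+ element (λ _ → 1#) ⟨
        sum (λ i → element i + 1#)           ≡⟨ sum-cong-≗ (λ i → Inverse.strictlyInverseˡ enumeration (element i + 1#)) ⟨
        sum (λ i → element (Inverse.from enumeration (element i + 1#)))
                                             ≡⟨ sum-permute element shift ⟨
        sum element                          ∎

  nonzero-cancel : ∀ {x z} → ¬ x ≡ 0# → x * z ≡ 0# → z ≡ 0#
  nonzero-cancel {x} {z} x≢0 xz≡0 with inverse x x≢0
  ... | y , xy≡1 = begin
    z              ≡⟨ *-identityˡ z ⟨
    1# * z         ≡⟨ cong (_* z) (trans (*-comm y x) xy≡1) ⟨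
    (y * x) * z    ≡⟨ *-assoc y x z ⟩
    y * (x * z)    ≡⟨ cong (y *_) xz≡0 ⟩
    y * 0#         ≡⟨ zeroʳ y ⟩
    0#             ∎

  pow-nonzero : ∀ {x} → ¬ x ≡ 0# → ∀ e → ¬ x ^^ e ≡ 0#
  pow-nonzero x≢0 zero    1≡0   = 0≢1 (sym 1≡0)
  pow-nonzero x≢0 (suc e) xxᵉ≡0 = pow-nonzero x≢0 e (nonzero-cancel x≢0 xxᵉ≡0)

  -- If q = p^e then p · 1 = 0, since (p · 1)^e = q · 1 = 0 and F has no zero divisors.
  -- The conclusion is double-negated: it is only ever used to derive a contradiction.
  prime-power-characteristic : ∀ p e → q ≡ p ℕ.^ e → ¬ ¬ fromℕ p ≡ 0#
  prime-power-characteristic p e q≡pᵉ p≢0 = pow-nonzero p≢0 e (begin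
    fromℕ p ^^ e     ≡⟨ fromℕ-^ p e ⟨
    fromℕ (p ℕ.^ e)  ≡⟨ cong fromℕ q≡pᵉ ⟨
    fromℕ q          ≡⟨ fromℕ-card ⟩
    0#               ∎)

  fromℕ-mod : ∀ p .{{_ : NonZero p}} → fromℕ p ≡ 0# → ∀ m → fromℕ m ≡ fromℕ (m % p)
  fromℕ-mod p p≡0 m = begin
    fromℕ m                                ≡⟨ cong fromℕ (m≡m%n+[m/n]*n m p) ⟩
    fromℕ (m % p ℕ.+ m / p ℕ.* p)          ≡⟨ fromℕ-+ (m % p) (m / p ℕ.* p) ⟩
    fromℕ (m % p) + fromℕ (m / p ℕ.* p)    ≡⟨ cong (fromℕ (m % p) +_) (fromℕ-* (m / p) p) ⟩
    fromℕ (m % p) + fromℕ (m / p) * fromℕ p ≡⟨ cong (λ t → fromℕ (m % p) + fromℕ (m / p) * t) p≡0 ⟩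
    fromℕ (m % p) + fromℕ (m / p) * 0#      ≡⟨ cong (fromℕ (m % p) +_) (zeroʳ _) ⟩
    fromℕ (m % p) + 0#                      ≡⟨ +-identityʳ _ ⟩
    fromℕ (m % p)                           ∎

  coeff-k1 : ∀ n i → coeff 1 n i ≡ fromℕ (diagonalTerm n i)
  coeff-k1 n i = begin
    fromℕ (diagonalTerm n i) - ((fromℕ 1 - 1#) * B) ≡⟨ cong (λ t → fromℕ (diagonalTerm n i) - (t * B)) 1-1≡0 ⟩
    fromℕ (diagonalTerm n i) - (0# * B)             ≡⟨ cong (λ t → fromℕ (diagonalTerm n i) - t) (zeroˡ B) ⟩
    fromℕ (diagonalTerm n i) - 0#                   ≡⟨ cong (fromℕ (diagonalTerm n i) +_) -0#≈0# ⟩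
    fromℕ (diagonalTerm n i) + 0#                   ≡⟨ +-identityʳ _ ⟩
    fromℕ (diagonalTerm n i)                        ∎
    where
      B = fromℕ (binomPred (n ℕ.∸ i ℕ.∸ 1) i)
      1-1≡0 : fromℕ 1 - 1# ≡ 0#
      1-1≡0 = trans (cong (_- 1#) (+-identityʳ 1#)) (-‿inverseʳ 1#)

  partialSum-at-0 : ∀ n m → partialSum 1 n 0# m ≡ 1#
  partialSum-at-0 n zero    = trans (*-identityʳ _) (trans (coeff-k1 n 0) (+-identityʳ 1#))
  partialSum-at-0 n (suc m) = begin
    partialSum 1 n 0# m + c * ((- 0#) * ((- 0#) ^^ m))  ≡⟨ cong (λ t → partialSum 1 n 0# m + c * (t * ((- 0#) ^^ m))) -0#≈0# ⟩
    partialSum 1 n 0# m + c * (0# * ((- 0#) ^^ m))      ≡⟨ cong (λ t → partialSum 1 n 0# m + c * t) (zeroˡ _) ⟩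
    partialSum 1 n 0# m + c * 0#                        ≡⟨ cong (partialSum 1 n 0# m +_) (zeroʳ c) ⟩
    partialSum 1 n 0# m + 0#                            ≡⟨ +-identityʳ _ ⟩
    partialSum 1 n 0# m                                 ≡⟨ partialSum-at-0 n m ⟩
    1#                                                  ∎
    where c = coeff 1 n (suc m)

  one-pow : ∀ i → 1# ^^ i ≡ 1#
  one-pow zero    = refl
  one-pow (suc i) = trans (*-identityˡ _) (one-pow i)

  partialSum-at-minus-1 : ∀ n m → partialSum 1 n (- 1#) m ≡ fromℕ (diagonalSum n m)
  partialSum-at-minus-1 n zero    = trans (*-identityʳ _) (coeff-k1 n 0)
  partialSum-at-minus-1 n (suc m) = begin
    partialSum 1 n (- 1#) m + coeff 1 n (suc m) * ((- (- 1#)) ^^ suc m)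
      ≡⟨ cong₂ (λ s t → s + coeff 1 n (suc m) * (t ^^ suc m)) (partialSum-at-minus-1 n m) (-‿involutive 1#) ⟩
    fromℕ (diagonalSum n m) + coeff 1 n (suc m) * (1# ^^ suc m)
      ≡⟨ cong₂ (λ s t → fromℕ (diagonalSum n m) + s * t) (coeff-k1 n (suc m)) (one-pow (suc m)) ⟩
    fromℕ (diagonalSum n m) + fromℕ (diagonalTerm n (suc m)) * 1#
      ≡⟨ cong (fromℕ (diagonalSum n m) +_) (*-identityʳ _) ⟩
    fromℕ (diagonalSum n m) + fromℕ (diagonalTerm n (suc m))
      ≡⟨ fromℕ-+ (diagonalSum n m) (diagonalTerm n (suc m)) ⟨
    fromℕ (diagonalSum n (suc m)) ∎

  D-at-minus-1 : ∀ m → D (suc m) 1 (- 1#) ≡ fromℕ (fib (suc (suc m)))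
  D-at-minus-1 m = begin
    partialSum 1 (suc m) (- 1#) (suc m / 2)   ≡⟨ partialSum-at-minus-1 (suc m) (suc m / 2) ⟩
    fromℕ (diagonalSum (suc m) (suc m / 2))   ≡⟨ cong fromℕ (diagonalSum-half (suc m)) ⟩
    fromℕ (diagonalSum (suc m) (suc m))       ≡⟨ cong fromℕ (diagonalSum≡fib (suc m)) ⟩
    fromℕ (fib (suc (suc m)))                 ∎

  collision : fromℕ 3 ≡ 0# → ∀ n → fib (suc n) % 3 ≡ 1 → D n 1 0# ≡ D n 1 (- 1#)
  collision char3 zero    _       = refl
  collision char3 (suc m) fib≡1 = begin
    D (suc m) 1 0#                   ≡⟨ partialSum-at-0 (suc m) (suc m / 2) ⟩
    1#                               ≡⟨ +-identityʳ 1# ⟨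
    fromℕ 1                          ≡⟨ cong fromℕ fib≡1 ⟨
    fromℕ (fib (suc (suc m)) % 3)    ≡⟨ fromℕ-mod 3 char3 (fib (suc (suc m))) ⟨
    fromℕ (fib (suc (suc m)))        ≡⟨ D-at-minus-1 m ⟨
    D (suc m) 1 (- 1#)               ∎

  0≢-1 : ¬ 0# ≡ - 1#
  0≢-1 0≡-1 = 0≢1 (sym (begin
    1#          ≡⟨ +-identityʳ 1# ⟨
    1# + 0#     ≡⟨ cong (1# +_) 0≡-1 ⟩
    1# - 1#     ≡⟨ -‿inverseʳ 1# ⟩
    0#          ∎))

open import Data.Nat using (_+_; _^_; _≥_)
open import Relation.Nullary using (¬_)
open import Data.Product using (_,_)
open import Relation.Binary.PropositionalEquality using (refl)
open Arithmetic using (fib-index)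

mainTheorem18 : (e : ℕ) → e ≥ 1 → (F : FiniteField (3 ^ e)) →
    (l₁ l₂ l₃ l₄ : ℕ) → Hypothesis l₁ l₂ l₃ l₄ →
    ¬ Dickson.IsPermutation F (Dickson.D F (3 ^ l₁ + 3 ^ l₂ + 3 ^ l₃ + 3 ^ l₄) 1)
mainTheorem18 e _ F l₁ l₂ l₃ l₄ hyp (injective , _) =
  prime-power-characteristic 3 e refl λ char3 →
    0≢-1 (injective (collision char3 n (fib-index l₁ l₂ l₃ l₄ hyp)))
  where
    open FieldFacts F
    n = 3 ^ l₁ + 3 ^ l₂ + 3 ^ l₃ + 3 ^ l₄
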